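{- Let $P^{\operatorname{dasc}}(t,x)=\sum_{n\ge0}\sum_{\pi\in\mathfrak S_n}t^{\operatorname{dasc}(\pi)}x^n/n!$ and $P^{\operatorname{lrdasc}}(t,x)=\sum_{n\ge0}\sum_{\pi\in\mathfrak S_n}t^{\operatorname{lrdasc}(\pi)}x^n/n!$. Then $$P^{\operatorname{dasc}}(t,x)=e^{(1-t)x}P^{\operatorname{lrdasc}}(t,x).$$
   Context: $\mathfrak S_n$ is the set of permutations of $[n]$. For $\pi=\pi_1\cdots\pi_n$: $i$ ($2\le i\le n-1$) is a double ascent if $\pi_{i-1}<\pi_i<\pi_{i+1}$; $i$ is a left double ascent if it is a double ascent or $i=1$ and $\pi_1<\pi_2$; $i$ is a right double ascent if it is a double ascent or $i=n$ and $\pi_{n-1}<\pi_n$; $i$ is a left-right double ascent if it is a left or right double ascent, or if $\pi=1$ and $i=1$. $\operatorname{dasc}$ and $\operatorname{lrdasc}$ count double ascents and left-right double ascents. -}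

module Defs where

open import Data.Nat using (ℕ; zero; suc; _∸_; _<ᵇ_)
open import Data.Bool using (Bool; true; false; _∧_; if_then_else_)
open import Data.List using (List; []; _∷_; [_]; map; concatMap; foldr; upTo)
open import Data.Integer using (ℤ; +_; _+_; _*_; _-_; _^_)
open import Data.Nat.Combinatorics using (_C_)

-- A permutation π = π₁⋯πₙ of [n] = {1,…,n} is represented by its one-line
-- notation as a list of naturals.

insertAll : ℕ → List ℕ → List (List ℕ)
insertAll x [] = [ x ] ∷ []
insertAll x (y ∷ ys) = (x ∷ y ∷ ys) ∷ map (y ∷_) (insertAll x ys)

perms : ℕ → List (List ℕ)
perms zero = [] ∷ []
perms (suc n) = concatMap (insertAll (suc n)) (perms n)

ind : Bool → ℕ
ind true = 1
ind false = 0

dasc : List ℕ → ℕ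
dasc (a ∷ b ∷ c ∷ r) = ind ((a <ᵇ b) ∧ (b <ᵇ c)) Data.Nat.+ dasc (b ∷ c ∷ r)
dasc _ = 0

-- position 1 is a left double ascent (n ≥ 2 and π₁ < π₂)
leftEnd : List ℕ → ℕ
leftEnd (a ∷ b ∷ _) = ind (a <ᵇ b)
leftEnd _ = 0

-- position n is a right double ascent (n ≥ 2 and π_{n-1} < π_n)
rightEnd : List ℕ → ℕ
rightEnd (a ∷ b ∷ []) = ind (a <ᵇ b)
rightEnd (a ∷ b ∷ c ∷ r) = rightEnd (b ∷ c ∷ r)
rightEnd _ = 0

-- the special case π = 1 (n = 1, i = 1)
single : List ℕ → ℕ
single (_ ∷ []) = 1
single _ = 0

lrdasc : List ℕ → ℕ
lrdasc π = dasc π Data.Nat.+ leftEnd π Data.Nat.+ rightEnd π Data.Nat.+ single π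

sumℤ : List ℤ → ℤ
sumℤ = foldr _+_ (+ 0)

-- n! [xⁿ] P^dasc(t,x) = Σ_{π ∈ 𝔖ₙ} t^{dasc π}
Pdasc : ℤ → ℕ → ℤ
Pdasc t n = sumℤ (map (λ π → t ^ dasc π) (perms n))

-- n! [xⁿ] P^lrdasc(t,x) = Σ_{π ∈ 𝔖ₙ} t^{lrdasc π}
Plrdasc : ℤ → ℕ → ℤ
Plrdasc t n = sumℤ (map (λ π → t ^ lrdasc π) (perms n))

-- n! [xⁿ] e^{(1-t)x} P^lrdasc(t,x) = Σ_{k=0}^{n} C(n,k) (1-t)^k Plrdasc_{n-k}(t)
RHS : ℤ → ℕ → ℤ
RHS t n = sumℤ (map (λ k → (+ (n C k)) * ((+ 1 - t) ^ k) * Plrdasc t (n ∸ k)) (upTo (suc n)))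

-- Coefficientwise the identity compares two sequences starting with 1.  The
-- left one satisfies a(n+1) = Σ_j C(n,j) a(j) r(n−j), with r(m) the sum of t
-- to the number of double ascents of π ∈ 𝔖ₘ followed by a letter +∞: split a
-- permutation of [n+1] as α (n+1) β.  The right one is the sum, over π ∈ 𝔖ₙ and
-- factorisations π = αβ with α increasing, of (1−t)^|α| t^lrdasc(β), and obeys
-- the same recurrence: the letter n+1 either ends α (a factor 1−t) or splits β
-- as before, except that an empty right part now weighs t instead of 1, and
-- these two defects cancel.
module Submission where

open import Defs
open import Data.Bool using (Bool; true; false; _∧_; if_then_else_)
open import Data.Bool.Properties using (T-≡)
open import Data.Integer using (ℤ; +_; _+_; _*_; _-_; _^_)
import Data.Integer.Properties as ℤP
open import Data.Integer.Tactic.RingSolver using (solve-∀)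
open import Data.List using (List; []; _∷_; map; concatMap; applyUpTo; _++_; length; take; drop)
open import Data.List.Relation.Binary.Pointwise as Pointwise using (Pointwise; []; _∷_)
open import Data.List.Relation.Unary.All as All using (All; []; _∷_)
import Data.List.Relation.Unary.All.Properties as Allₚ
open import Data.Nat as ℕ using (ℕ; zero; suc; _∸_; _<ᵇ_; _≤_; _<_; z≤n; s≤s; _⊔_)
import Data.Nat.Properties as ℕP
open import Data.Nat.Combinatorics using (_C_; nCk+nC[k+1]≡[n+1]C[k+1]; nCk≡nC[n∸k]; k>n⇒nCk≡0)
open import Data.Product using (_×_; _,_)
open import Data.Sum using (inj₁; inj₂)
open import Function using (_∘_; Equivalence)
open import Relation.Binary.PropositionalEquality
open ≡-Reasoning

sumOver : {A : Set} → (A → ℤ) → List A → ℤ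
sumOver f xs = sumℤ (map f xs)

module _ {A : Set} where

  sumOver-++ : (f : A → ℤ) (xs ys : List A) → sumOver f (xs ++ ys) ≡ sumOver f xs + sumOver f ys
  sumOver-++ f [] ys = sym (ℤP.+-identityˡ _)
  sumOver-++ f (x ∷ xs) ys = trans (cong (_+_ (f x)) (sumOver-++ f xs ys)) (sym (ℤP.+-assoc (f x) _ _))

  sumOver-+ : (f g : A → ℤ) (xs : List A) → sumOver (λ x → f x + g x) xs ≡ sumOver f xs + sumOver g xs
  sumOver-+ f g [] = refl
  sumOver-+ f g (x ∷ xs) =
    trans (cong (_+_ (f x + g x)) (sumOver-+ f g xs)) (swap (f x) (g x) (sumOver f xs) (sumOver g xs))
    where
    swap : ∀ a b c d → a + b + (c + d) ≡ a + c + (b + d)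
    swap = solve-∀

  sumOver-* : (c : ℤ) (f : A → ℤ) (xs : List A) → sumOver (λ x → c * f x) xs ≡ c * sumOver f xs
  sumOver-* c f [] = sym (ℤP.*-zeroʳ c)
  sumOver-* c f (x ∷ xs) = trans (cong (_+_ (c * f x)) (sumOver-* c f xs)) (sym (ℤP.*-distribˡ-+ c (f x) _))

  sumOver-zero : (xs : List A) → sumOver (λ _ → + 0) xs ≡ + 0
  sumOver-zero [] = refl
  sumOver-zero (_ ∷ xs) = trans (ℤP.+-identityˡ _) (sumOver-zero xs)

  sumOver-cong : {f g : A → ℤ} (xs : List A) → (∀ x → f x ≡ g x) → sumOver f xs ≡ sumOver g xs
  sumOver-cong [] f≡g = refl
  sumOver-cong (x ∷ xs) f≡g = cong₂ _+_ (f≡g x) (sumOver-cong xs f≡g)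

  sumOver-congᴬ : {P : A → Set} {f g : A → ℤ} {xs : List A} →
                  All P xs → (∀ x → P x → f x ≡ g x) → sumOver f xs ≡ sumOver g xs
  sumOver-congᴬ [] f≡g = refl
  sumOver-congᴬ (px ∷ pxs) f≡g = cong₂ _+_ (f≡g _ px) (sumOver-congᴬ pxs f≡g)

sumOver-concatMap : {A B : Set} (f : B → ℤ) (g : A → List B) (xs : List A) →
                    sumOver f (concatMap g xs) ≡ sumOver (sumOver f ∘ g) xs
sumOver-concatMap f g [] = refl
sumOver-concatMap f g (x ∷ xs) =
  trans (sumOver-++ f (g x) (concatMap g xs)) (cong (_+_ (sumOver f (g x))) (sumOver-concatMap f g xs))

sumOver-map : {A B : Set} (f : B → ℤ) (g : A → B) (xs : List A) → sumOver f (map g xs) ≡ sumOver (f ∘ g) xs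
sumOver-map f g [] = refl
sumOver-map f g (x ∷ xs) = cong (_+_ (f (g x))) (sumOver-map f g xs)

sumOver-Pointwise : {A B : Set} {f : A → ℤ} {g : B → ℤ} {xs : List A} {ys : List B} →
                    Pointwise (λ x y → f x ≡ g y) xs ys → sumOver f xs ≡ sumOver g ys
sumOver-Pointwise [] = refl
sumOver-Pointwise (e ∷ es) = cong₂ _+_ e (sumOver-Pointwise es)

sumTo : (ℕ → ℤ) → ℕ → ℤ
sumTo φ zero = φ 0
sumTo φ (suc n) = φ 0 + sumTo (φ ∘ suc) n

sumTo-cong : ∀ {φ ψ : ℕ → ℤ} n → (∀ j → j ≤ n → φ j ≡ ψ j) → sumTo φ n ≡ sumTo ψ n
sumTo-cong zero φ≡ψ = φ≡ψ 0 z≤n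
sumTo-cong (suc n) φ≡ψ = cong₂ _+_ (φ≡ψ 0 z≤n) (sumTo-cong n (λ j j≤n → φ≡ψ (suc j) (s≤s j≤n)))

sumTo-+ : ∀ (φ ψ : ℕ → ℤ) n → sumTo (λ j → φ j + ψ j) n ≡ sumTo φ n + sumTo ψ n
sumTo-+ φ ψ zero = refl
sumTo-+ φ ψ (suc n) =
  trans (cong (_+_ (φ 0 + ψ 0)) (sumTo-+ (φ ∘ suc) (ψ ∘ suc) n)) (swap (φ 0) (ψ 0) _ _)
  where
  swap : ∀ a b c d → a + b + (c + d) ≡ a + c + (b + d)
  swap = solve-∀

sumTo-suc : ∀ (φ : ℕ → ℤ) n → φ 0 + sumTo (φ ∘ suc) n ≡ sumTo φ n + φ (suc n)
sumTo-suc φ zero = refl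
sumTo-suc φ (suc n) =
  trans (cong (_+_ (φ 0)) (sumTo-suc (φ ∘ suc) n)) (sym (ℤP.+-assoc (φ 0) _ _))

sumTo-reverse : ∀ (φ : ℕ → ℤ) n → sumTo φ n ≡ sumTo (λ j → φ (n ∸ j)) n
sumTo-reverse φ zero = refl
sumTo-reverse φ (suc n) = begin
  φ 0 + sumTo (φ ∘ suc) n                 ≡⟨ sumTo-suc φ n ⟩
  sumTo φ n + φ (suc n)                   ≡⟨ cong (_+ φ (suc n)) (sumTo-reverse φ n) ⟩
  sumTo (λ j → φ (n ∸ j)) n + φ (suc n)   ≡⟨ ℤP.+-comm _ (φ (suc n)) ⟩
  φ (suc n) + sumTo (λ j → φ (n ∸ j)) n   ∎

sumOver-applyUpTo : ∀ (φ : ℕ → ℤ) (f : ℕ → ℕ) n → sumOver φ (applyUpTo f (suc n)) ≡ sumTo (φ ∘ f) n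
sumOver-applyUpTo φ f zero = ℤP.+-identityʳ _
sumOver-applyUpTo φ f (suc n) = cong (_+_ (φ (f 0))) (sumOver-applyUpTo φ (f ∘ suc) n)

-- The product of exponential generating functions, on coefficients.
infixl 7 _⊛_
_⊛_ : (ℕ → ℤ) → (ℕ → ℤ) → ℕ → ℤ
(F ⊛ G) n = sumTo (λ j → + (n C j) * F j * G (n ∸ j)) n

⊛-cong : ∀ {F F' G G' : ℕ → ℤ} n → (∀ j → j ≤ n → F j ≡ F' j) → (∀ j → j ≤ n → G j ≡ G' j) →
         (F ⊛ G) n ≡ (F' ⊛ G') n
⊛-cong n F≡F' G≡G' =
  sumTo-cong n (λ j j≤n → cong₂ _*_ (cong (+ (n C j) *_) (F≡F' j j≤n)) (G≡G' (n ∸ j) (ℕP.m∸n≤m n j)))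

⊛-comm : ∀ F G n → (F ⊛ G) n ≡ (G ⊛ F) n
⊛-comm F G n = trans (sumTo-reverse _ n) (sumTo-cong n λ j j≤n → begin
  + (n C (n ∸ j)) * F (n ∸ j) * G (n ∸ (n ∸ j))
    ≡⟨ cong₂ (λ c k → + c * F (n ∸ j) * G k) (sym (nCk≡nC[n∸k] j≤n)) (ℕP.m∸[m∸n]≡n j≤n) ⟩
  + (n C j) * F (n ∸ j) * G j
    ≡⟨ swap (+ (n C j)) _ _ ⟩
  + (n C j) * G j * F (n ∸ j) ∎)
  where
  swap : ∀ a b c → a * b * c ≡ a * c * b
  swap = solve-∀

-- Pascal's rule: the coefficientwise form of (F G)' = F' G + F G'.
⊛-suc : ∀ F G n → (F ⊛ G) (suc n) ≡ (F ∘ suc ⊛ G) n + (F ⊛ G ∘ suc) n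
⊛-suc F G n = begin
  (F ⊛ G) (suc n)                          ≡⟨ cong (_+_ (γ 0)) (sumTo-cong n (λ j _ → pascal j)) ⟩
  γ 0 + sumTo (λ j → α j + γ (suc j)) n    ≡⟨ cong (_+_ (γ 0)) (sumTo-+ α (γ ∘ suc) n) ⟩
  γ 0 + (sumTo α n + sumTo (γ ∘ suc) n)    ≡⟨ exchange (γ 0) (sumTo α n) _ ⟩
  sumTo α n + (γ 0 + sumTo (γ ∘ suc) n)    ≡⟨ cong (_+_ (sumTo α n)) (sumTo-suc γ n) ⟩
  sumTo α n + (sumTo γ n + γ (suc n))      ≡⟨ cong (λ c → sumTo α n + (sumTo γ n + c)) γ-last ⟩
  sumTo α n + (sumTo γ n + + 0)            ≡⟨ cong (_+_ (sumTo α n)) (ℤP.+-identityʳ _) ⟩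
  sumTo α n + sumTo γ n                    ≡⟨ cong (_+_ (sumTo α n)) (sumTo-cong n γ≡) ⟩
  (F ∘ suc ⊛ G) n + (F ⊛ G ∘ suc) n        ∎
  where
  α γ : ℕ → ℤ
  α j = + (n C j) * F (suc j) * G (n ∸ j)
  γ j = + (n C j) * F j * G (suc n ∸ j)
  exchange : ∀ a b c → a + (b + c) ≡ b + (a + c)
  exchange = solve-∀
  pascal : ∀ j → + (suc n C suc j) * F (suc j) * G (n ∸ j) ≡ α j + γ (suc j)
  pascal j = begin
    + (suc n C suc j) * F (suc j) * G (n ∸ j)
      ≡⟨ cong (λ c → + c * F (suc j) * G (n ∸ j)) (sym (nCk+nC[k+1]≡[n+1]C[k+1] n j)) ⟩
    + (n C j ℕ.+ n C suc j) * F (suc j) * G (n ∸ j)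
      ≡⟨ cong (λ c → c * F (suc j) * G (n ∸ j)) (ℤP.pos-+ (n C j) (n C suc j)) ⟩
    (+ (n C j) + + (n C suc j)) * F (suc j) * G (n ∸ j)
      ≡⟨ distrib (+ (n C j)) (+ (n C suc j)) (F (suc j)) (G (n ∸ j)) ⟩
    α j + γ (suc j) ∎
    where
    distrib : ∀ a b c d → (a + b) * c * d ≡ a * c * d + b * c * d
    distrib = solve-∀
  γ-last : γ (suc n) ≡ + 0
  γ-last rewrite k>n⇒nCk≡0 (ℕP.n<1+n n) = refl
  γ≡ : ∀ j → j ≤ n → γ j ≡ + (n C j) * F j * G (suc (n ∸ j))
  γ≡ j j≤n = cong (λ k → + (n C j) * F j * G k) (ℕP.+-∸-assoc 1 j≤n)

⊛-recurrence-unique : ∀ (a b r : ℕ → ℤ) → a 0 ≡ b 0 →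
                      (∀ n → a (suc n) ≡ (a ⊛ r) n) → (∀ n → b (suc n) ≡ (b ⊛ r) n) →
                      ∀ n → a n ≡ b n
⊛-recurrence-unique a b r a₀≡b₀ a-rec b-rec n = agreeUpTo n n ℕP.≤-refl
  where
  agreeUpTo : ∀ n j → j ≤ n → a j ≡ b j
  agreeUpTo zero zero _ = a₀≡b₀
  agreeUpTo (suc n) j j≤1+n with ℕP.m≤n⇒m<n∨m≡n j≤1+n
  ... | inj₁ (s≤s j≤n) = agreeUpTo n j j≤n
  ... | inj₂ refl = begin
    a (suc n)      ≡⟨ a-rec n ⟩
    (a ⊛ r) n      ≡⟨ ⊛-cong {G = r} n (agreeUpTo n) (λ _ _ → refl) ⟩
    (b ⊛ r) n      ≡⟨ b-rec n ⟨
    b (suc n)      ∎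

WordFn : Set
WordFn = List ℕ → ℤ

-- (f ∙ g) w = Σ over factorisations w = αβ of f α · g β.
infixl 7 _∙_
_∙_ : WordFn → WordFn → WordFn
(f ∙ g) [] = f [] * g []
(f ∙ g) (x ∷ w) = f [] * g (x ∷ w) + (f ∘ (x ∷_) ∙ g) w

∙-cong : ∀ {f f' g g' : WordFn} w → (∀ u → f u ≡ f' u) → (∀ u → g u ≡ g' u) → (f ∙ g) w ≡ (f' ∙ g') w
∙-cong [] f≡f' g≡g' = cong₂ _*_ (f≡f' []) (g≡g' [])
∙-cong (x ∷ w) f≡f' g≡g' =
  cong₂ _+_ (cong₂ _*_ (f≡f' []) (g≡g' (x ∷ w))) (∙-cong w (f≡f' ∘ (x ∷_)) g≡g')

∙-distribʳ-+ : ∀ (f f' g : WordFn) w → ((λ u → f u + f' u) ∙ g) w ≡ (f ∙ g) w + (f' ∙ g) w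
∙-distribʳ-+ f f' g [] = ℤP.*-distribʳ-+ (g []) (f []) (f' [])
∙-distribʳ-+ f f' g (x ∷ w) =
  trans (cong (_+_ ((f [] + f' []) * g (x ∷ w))) (∙-distribʳ-+ (f ∘ (x ∷_)) (f' ∘ (x ∷_)) g w))
        (regroup (f []) (f' []) (g (x ∷ w)) _ _)
  where
  regroup : ∀ a b c d e → (a + b) * c + (d + e) ≡ a * c + d + (b * c + e)
  regroup = solve-∀

∙-*ˡ : ∀ (c : ℤ) (f g : WordFn) w → ((λ u → c * f u) ∙ g) w ≡ c * (f ∙ g) w
∙-*ˡ c f g [] = ℤP.*-assoc c (f []) (g [])
∙-*ˡ c f g (x ∷ w) =
  trans (cong (_+_ (c * f [] * g (x ∷ w))) (∙-*ˡ c (f ∘ (x ∷_)) g w)) (factor c (f []) (g (x ∷ w)) _)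
  where
  factor : ∀ a b d e → a * b * d + a * e ≡ a * (b * d + e)
  factor = solve-∀

∙-assoc : ∀ (f g h : WordFn) w → (f ∙ g ∙ h) w ≡ (f ∙ (g ∙ h)) w
∙-assoc f g h [] = ℤP.*-assoc (f []) (g []) (h [])
∙-assoc f g h (x ∷ w) = begin
  f [] * g [] * h (x ∷ w) + ((λ u → f [] * g (x ∷ u) + (f ∘ (x ∷_) ∙ g) u) ∙ h) w
    ≡⟨ cong (_+_ (f [] * g [] * h (x ∷ w))) (∙-distribʳ-+ _ _ h w) ⟩
  f [] * g [] * h (x ∷ w) + (((λ u → f [] * g (x ∷ u)) ∙ h) w + (f ∘ (x ∷_) ∙ g ∙ h) w)
    ≡⟨ cong (_+_ (f [] * g [] * h (x ∷ w))) (cong₂ _+_ (∙-*ˡ (f []) (g ∘ (x ∷_)) h w) (∙-assoc (f ∘ (x ∷_)) g h w)) ⟩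
  f [] * g [] * h (x ∷ w) + (f [] * (g ∘ (x ∷_) ∙ h) w + (f ∘ (x ∷_) ∙ (g ∙ h)) w)
    ≡⟨ factor (f []) (g []) (h (x ∷ w)) _ _ ⟩
  f [] * (g [] * h (x ∷ w) + (g ∘ (x ∷_) ∙ h) w) + (f ∘ (x ∷_) ∙ (g ∙ h)) w ∎
  where
  factor : ∀ a b c d e → a * b * c + (a * d + e) ≡ a * (b * c + d) + e
  factor = solve-∀

∙-update-[] : ∀ (f g g' : WordFn) c → g [] ≡ g' [] + c → (∀ x u → g (x ∷ u) ≡ g' (x ∷ u)) →
              ∀ w → (f ∙ g) w ≡ (f ∙ g') w + f w * c
∙-update-[] f g g' c g[] g∷ [] = trans (cong (f [] *_) g[]) (ℤP.*-distribˡ-+ (f []) _ _)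
∙-update-[] f g g' c g[] g∷ (x ∷ w) = begin
  f [] * g (x ∷ w) + (f ∘ (x ∷_) ∙ g) w
    ≡⟨ cong₂ _+_ (cong (f [] *_) (g∷ x w)) (∙-update-[] (f ∘ (x ∷_)) g g' c g[] g∷ w) ⟩
  f [] * g' (x ∷ w) + ((f ∘ (x ∷_) ∙ g') w + f (x ∷ w) * c)
    ≡⟨ ℤP.+-assoc (f [] * g' (x ∷ w)) _ _ ⟨
  f [] * g' (x ∷ w) + (f ∘ (x ∷_) ∙ g') w + f (x ∷ w) * c ∎

∙-take-drop : ∀ (f g : WordFn) w → (f ∙ g) w ≡ sumTo (λ j → f (take j w) * g (drop j w)) (length w)
∙-take-drop f g [] = refl
∙-take-drop f g (x ∷ w) = cong (_+_ (f [] * g (x ∷ w))) (∙-take-drop (f ∘ (x ∷_)) g w)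

∂ : ℕ → WordFn → WordFn
∂ M f w = sumOver f (insertAll M w)

∂-[] : ∀ M f → ∂ M f [] ≡ f (M ∷ [])
∂-[] M f = ℤP.+-identityʳ _

∂-∷ : ∀ M f y w → ∂ M f (y ∷ w) ≡ f (M ∷ y ∷ w) + ∂ M (f ∘ (y ∷_)) w
∂-∷ M f y w = cong (_+_ (f (M ∷ y ∷ w))) (sumOver-map f (y ∷_) (insertAll M w))

∂-* : ∀ M c f w → ∂ M (λ u → c * f u) w ≡ c * ∂ M f w
∂-* M c f w = sumOver-* c f (insertAll M w)

∂-∙ : ∀ M (f g : WordFn) w → ∂ M (f ∙ g) w ≡ (∂ M f ∙ g) w + (f ∙ ∂ M g) w
∂-∙ M f g [] = shuffle (f []) (g (M ∷ [])) (f (M ∷ [])) (g [])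
  where
  shuffle : ∀ a b c d → a * b + c * d + + 0 ≡ (c + + 0) * d + a * (b + + 0)
  shuffle = solve-∀
∂-∙ M f g (y ∷ w) = begin
  ∂ M (f ∙ g) (y ∷ w)
    ≡⟨ ∂-∷ M (f ∙ g) y w ⟩
  (f ∙ g) (M ∷ y ∷ w) + ∂ M (λ u → f [] * g (y ∷ u) + (f ∘ (y ∷_) ∙ g) u) w
    ≡⟨ cong (_+_ ((f ∙ g) (M ∷ y ∷ w))) (sumOver-+ _ _ (insertAll M w)) ⟩
  (f ∙ g) (M ∷ y ∷ w) + (∂ M (λ u → f [] * g (y ∷ u)) w + ∂ M (f ∘ (y ∷_) ∙ g) w)
    ≡⟨ cong (_+_ ((f ∙ g) (M ∷ y ∷ w))) (cong₂ _+_ (∂-* M (f []) (g ∘ (y ∷_)) w) (∂-∙ M (f ∘ (y ∷_)) g w)) ⟩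
  a * b + (c * d + e) + (a * p + (q + r))
    ≡⟨ regroup a b c d e p q r ⟩
  (c + + 0) * d + (e + q) + (a * (b + p) + r)
    ≡⟨ cong₂ (λ k l → (c + + 0) * d + k + (a * l + r)) (sym ∂f-tail) (sym (∂-∷ M g y w)) ⟩
  (∂ M f ∙ g) (y ∷ w) + (f ∙ ∂ M g) (y ∷ w) ∎
  where
  a = f []
  b = g (M ∷ y ∷ w)
  c = f (M ∷ [])
  d = g (y ∷ w)
  e = (f ∘ (M ∷_) ∘ (y ∷_) ∙ g) w
  p = ∂ M (g ∘ (y ∷_)) w
  q = (∂ M (f ∘ (y ∷_)) ∙ g) w
  r = (f ∘ (y ∷_) ∙ ∂ M g) w
  regroup : ∀ a b c d e p q r → a * b + (c * d + e) + (a * p + (q + r)) ≡ (c + + 0) * d + (e + q) + (a * (b + p) + r)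
  regroup = solve-∀
  ∂f-tail : (∂ M f ∘ (y ∷_) ∙ g) w ≡ e + q
  ∂f-tail = trans (∙-cong w (∂-∷ M f y) (λ _ → refl)) (∙-distribʳ-+ (f ∘ (M ∷_) ∘ (y ∷_)) (∂ M (f ∘ (y ∷_))) g w)

Below : ℕ → List ℕ → Set
Below M = All (_< M)

∙-congᴮ : ∀ {M} {f f' g g' : WordFn} {w} → (∀ u → Below M u → f u ≡ f' u) → (∀ u → Below M u → g u ≡ g' u) →
          Below M w → (f ∙ g) w ≡ (f' ∙ g') w
∙-congᴮ {w = []} f≡f' g≡g' _ = cong₂ _*_ (f≡f' [] []) (g≡g' [] [])
∙-congᴮ {w = x ∷ w} f≡f' g≡g' (x<M ∷ w<M) =
  cong₂ _+_ (cong₂ _*_ (f≡f' [] []) (g≡g' (x ∷ w) (x<M ∷ w<M)))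
            (∙-congᴮ (λ u u<M → f≡f' (x ∷ u) (x<M ∷ u<M)) g≡g' w<M)

∂-factor : ∀ M (h f g : WordFn) → (∀ α β → Below M α → Below M β → h (α ++ M ∷ β) ≡ f α * g β) →
           ∀ w → Below M w → ∂ M h w ≡ (f ∙ g) w
∂-factor M h f g h≡ [] _ = trans (∂-[] M h) (h≡ [] [] [] [])
∂-factor M h f g h≡ (y ∷ w) (y<M ∷ w<M) =
  trans (∂-∷ M h y w)
        (cong₂ _+_ (h≡ [] (y ∷ w) [] (y<M ∷ w<M))
                   (∂-factor M (h ∘ (y ∷_)) (f ∘ (y ∷_)) g (λ α β α<M β<M → h≡ (y ∷ α) β (y<M ∷ α<M) β<M) w w<M))

-- Order isomorphism of words

<ᵇ-true : ∀ {x M} → x < M → (x <ᵇ M) ≡ true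
<ᵇ-true x<M = Equivalence.to T-≡ (ℕP.<⇒<ᵇ x<M)

>ᵇ-false : ∀ {x M} → x < M → (M <ᵇ x) ≡ false
>ᵇ-false {zero} {suc M} _ = refl
>ᵇ-false {suc x} {suc M} (s≤s x<M) = >ᵇ-false x<M

SameOrder : ℕ → ℕ → ℕ → ℕ → Set
SameOrder a a' x x' = ((a <ᵇ x) ≡ (a' <ᵇ x')) × ((x <ᵇ a) ≡ (x' <ᵇ a'))

below⇒SameOrder : ∀ {x x' a a'} → x < a → x' < a' → SameOrder x x' a a'
below⇒SameOrder x<a x'<a' = trans (<ᵇ-true x<a) (sym (<ᵇ-true x'<a')) , trans (>ᵇ-false x<a) (sym (>ᵇ-false x'<a'))

above⇒SameOrder : ∀ {x x' a a'} → x < a → x' < a' → SameOrder a a' x x'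
above⇒SameOrder x<a x'<a' = trans (>ᵇ-false x<a) (sym (>ᵇ-false x'<a')) , trans (<ᵇ-true x<a) (sym (<ᵇ-true x'<a'))

infix 4 _≅_
data _≅_ : List ℕ → List ℕ → Set where
  [] : [] ≅ []
  _∷_ : ∀ {a a' w w'} → Pointwise (SameOrder a a') w w' → w ≅ w' → a ∷ w ≅ a' ∷ w'

OrderInvariant : WordFn → Set
OrderInvariant f = ∀ {w w'} → w ≅ w' → f w ≡ f w'

≅-refl : ∀ w → w ≅ w
≅-refl [] = []
≅-refl (x ∷ w) = Pointwise.refl (refl , refl) ∷ ≅-refl w

≅-length : ∀ {w w'} → w ≅ w' → length w ≡ length w'
≅-length [] = refl
≅-length (_ ∷ w≅w') = cong suc (≅-length w≅w')

Pointwise-take : ∀ {A B : Set} {R : A → B → Set} {xs ys} j → Pointwise R xs ys → Pointwise R (take j xs) (take j ys)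
Pointwise-take zero _ = []
Pointwise-take (suc j) [] = []
Pointwise-take (suc j) (r ∷ rs) = r ∷ Pointwise-take j rs

≅-take : ∀ {w w'} j → w ≅ w' → take j w ≅ take j w'
≅-take zero _ = []
≅-take (suc j) [] = []
≅-take (suc j) (p ∷ w≅w') = Pointwise-take j p ∷ ≅-take j w≅w'

≅-drop : ∀ {w w'} j → w ≅ w' → drop j w ≅ drop j w'
≅-drop zero w≅w' = w≅w'
≅-drop (suc j) [] = []
≅-drop (suc j) (_ ∷ w≅w') = ≅-drop j w≅w'

∙-invariant : ∀ {f g} → OrderInvariant f → OrderInvariant g → OrderInvariant (f ∙ g)
∙-invariant {f} {g} f-inv g-inv {w} {w'} w≅w' = begin
  (f ∙ g) w                                                ≡⟨ ∙-take-drop f g w ⟩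
  sumTo (λ j → f (take j w) * g (drop j w)) (length w)     ≡⟨ sumTo-cong (length w) (λ j _ →
                                                                cong₂ _*_ (f-inv (≅-take j w≅w')) (g-inv (≅-drop j w≅w'))) ⟩
  sumTo (λ j → f (take j w') * g (drop j w')) (length w)   ≡⟨ cong (sumTo _) (≅-length w≅w') ⟩
  sumTo (λ j → f (take j w') * g (drop j w')) (length w')  ≡⟨ ∙-take-drop f g w' ⟨
  (f ∙ g) w'                                               ∎

Pointwise-zipWith : ∀ {A B : Set} {R S T : A → B → Set} {xs ys} → (∀ {x y} → R x y → S x y → T x y) →
                    Pointwise R xs ys → Pointwise S xs ys → Pointwise T xs ys
Pointwise-zipWith _ [] [] = []
Pointwise-zipWith f (r ∷ rs) (s ∷ ss) = f r s ∷ Pointwise-zipWith f rs ss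

Below-SameOrder : ∀ {a a' w w'} → Below a w → Below a' w' → w ≅ w' → Pointwise (SameOrder a a') w w'
Below-SameOrder [] [] [] = []
Below-SameOrder (x<a ∷ w<a) (x'<a' ∷ w'<a') (_ ∷ w≅w') = above⇒SameOrder x<a x'<a' ∷ Below-SameOrder w<a w'<a' w≅w'

insertAll-SameOrder : ∀ {c c' a a' w w'} → Pointwise (SameOrder c c') w w' → c < a → c' < a' →
                      Pointwise (Pointwise (SameOrder c c')) (insertAll a w) (insertAll a' w')
insertAll-SameOrder [] c<a c'<a' = (below⇒SameOrder c<a c'<a' ∷ []) ∷ []
insertAll-SameOrder {w = y ∷ _} {y' ∷ _} (p ∷ ps) c<a c'<a' =
  (below⇒SameOrder c<a c'<a' ∷ p ∷ ps)
  ∷ Pointwise.map⁺ (y ∷_) (y' ∷_) (Pointwise.map (p ∷_) (insertAll-SameOrder ps c<a c'<a'))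

insertAll-≅ : ∀ {a a' w w'} → w ≅ w' → Below a w → Below a' w' → Pointwise _≅_ (insertAll a w) (insertAll a' w')
insertAll-≅ [] [] [] = ([] ∷ []) ∷ []
insertAll-≅ {w = y ∷ _} {y' ∷ _} (p ∷ w≅w') (y<a ∷ w<a) (y'<a' ∷ w'<a') =
  (Below-SameOrder (y<a ∷ w<a) (y'<a' ∷ w'<a') (p ∷ w≅w') ∷ p ∷ w≅w')
  ∷ Pointwise.map⁺ (y ∷_) (y' ∷_) (Pointwise-zipWith (λ q v≅v' → q ∷ v≅v')
                                     (insertAll-SameOrder p y<a y'<a') (insertAll-≅ w≅w' w<a w'<a'))

maxLetter : List ℕ → ℕ
maxLetter [] = 0
maxLetter (x ∷ w) = x ⊔ maxLetter w

Below-mono : ∀ {M N w} → M ≤ N → Below M w → Below N w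
Below-mono M≤N = All.map (λ x<M → ℕP.<-≤-trans x<M M≤N)

Below-maxLetter : ∀ w → Below (suc (maxLetter w)) w
Below-maxLetter [] = []
Below-maxLetter (x ∷ w) =
  s≤s (ℕP.m≤m⊔n x (maxLetter w)) ∷ Below-mono (s≤s (ℕP.m≤n⊔m x (maxLetter w))) (Below-maxLetter w)

∂max : WordFn → WordFn
∂max f w = ∂ (suc (maxLetter w)) f w

∂max-invariant : ∀ {f} → OrderInvariant f → OrderInvariant (∂max f)
∂max-invariant f-inv {w} {w'} w≅w' =
  sumOver-Pointwise (Pointwise.map f-inv (insertAll-≅ w≅w' (Below-maxLetter w) (Below-maxLetter w')))

∂≡∂max : ∀ {f M w} → OrderInvariant f → Below M w → ∂ M f w ≡ ∂max f w
∂≡∂max {w = w} f-inv w<M = sumOver-Pointwise (Pointwise.map f-inv (insertAll-≅ (≅-refl w) w<M (Below-maxLetter w)))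

∂-∙-max : ∀ {M f g w} → OrderInvariant f → OrderInvariant g → Below M w →
          ∂ M (f ∙ g) w ≡ (∂max f ∙ g) w + (f ∙ ∂max g) w
∂-∙-max {M} {f} {g} {w} f-inv g-inv w<M =
  trans (∂-∙ M f g w) (cong₂ _+_ (∙-congᴮ (λ _ u<M → ∂≡∂max f-inv u<M) (λ _ _ → refl) w<M)
                                 (∙-congᴮ (λ _ _ → refl) (λ _ u<M → ∂≡∂max g-inv u<M) w<M))

insertAll-Below : ∀ {M a w} → Below M w → a < M → All (Below M) (insertAll a w)
insertAll-Below [] a<M = (a<M ∷ []) ∷ []
insertAll-Below (y<M ∷ w<M) a<M = (a<M ∷ y<M ∷ w<M) ∷ Allₚ.map⁺ (All.map (y<M ∷_) (insertAll-Below w<M a<M))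

perms-Below : ∀ n → All (Below (suc n)) (perms n)
perms-Below zero = [] ∷ []
perms-Below (suc n) =
  Allₚ.concat⁺ (Allₚ.map⁺ (All.map (λ π<n → insertAll-Below (Below-mono (ℕP.n≤1+n _) π<n) ℕP.≤-refl) (perms-Below n)))

sumPerms : WordFn → ℕ → ℤ
sumPerms f n = sumOver f (perms n)

sumPerms-suc : ∀ f n → sumPerms f (suc n) ≡ sumPerms (∂ (suc n) f) n
sumPerms-suc f n = sumOver-concatMap f (insertAll (suc n)) (perms n)

sumPerms-∂ : ∀ {f g} n → (∀ π → Below (suc n) π → ∂ (suc n) f π ≡ g π) → sumPerms f (suc n) ≡ sumPerms g n
sumPerms-∂ {f} n ∂f≡g = trans (sumPerms-suc f n) (sumOver-congᴬ (perms-Below n) ∂f≡g)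

sumPerms-∂max : ∀ {f} → OrderInvariant f → ∀ n → sumPerms (∂max f) n ≡ sumPerms f (suc n)
sumPerms-∂max f-inv n = sym (sumPerms-∂ n (λ _ π<n → ∂≡∂max f-inv π<n))

-- Inserting n+1 obeys the same Leibniz rule on both sides (∂-∙-max and ⊛-suc).
sumPerms-∙ : ∀ n {f g} → OrderInvariant f → OrderInvariant g → sumPerms (f ∙ g) n ≡ (sumPerms f ⊛ sumPerms g) n
sumPerms-∙ zero {f} {g} _ _ = unit (f []) (g [])
  where
  unit : ∀ a b → a * b + + 0 ≡ + 1 * (a + + 0) * (b + + 0)
  unit = solve-∀
sumPerms-∙ (suc n) {f} {g} f-inv g-inv = begin
  sumPerms (f ∙ g) (suc n)
    ≡⟨ sumPerms-∂ n (λ _ π<n → ∂-∙-max f-inv g-inv π<n) ⟩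
  sumPerms (λ π → (∂max f ∙ g) π + (f ∙ ∂max g) π) n
    ≡⟨ sumOver-+ (∂max f ∙ g) (f ∙ ∂max g) (perms n) ⟩
  sumPerms (∂max f ∙ g) n + sumPerms (f ∙ ∂max g) n
    ≡⟨ cong₂ _+_ (sumPerms-∙ n (∂max-invariant f-inv) g-inv) (sumPerms-∙ n f-inv (∂max-invariant g-inv)) ⟩
  (sumPerms (∂max f) ⊛ sumPerms g) n + (sumPerms f ⊛ sumPerms (∂max g)) n
    ≡⟨ cong₂ _+_ (⊛-cong {G = sumPerms g} n (λ j _ → sumPerms-∂max f-inv j) (λ _ _ → refl))
                 (⊛-cong {F = sumPerms f} n (λ _ _ → refl) (λ j _ → sumPerms-∂max g-inv j)) ⟩
  (sumPerms f ∘ suc ⊛ sumPerms g) n + (sumPerms f ⊛ sumPerms g ∘ suc) n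
    ≡⟨ ⊛-suc (sumPerms f) (sumPerms g) n ⟨
  (sumPerms f ⊛ sumPerms g) (suc n) ∎

-- Double ascents with boundary letters

-- dascWith lo hi w counts the double ascents of w framed by a letter −∞ on
-- the left when lo and by +∞ on the right when hi; in dascAt p x w hi the flag
-- p records whether the letter preceding x is smaller than x.
dascAt : Bool → ℕ → List ℕ → Bool → ℕ
dascAt p x [] hi = ind (p ∧ hi)
dascAt p x (y ∷ w) hi = ind (p ∧ (x <ᵇ y)) ℕ.+ dascAt (x <ᵇ y) y w hi

dascWith : Bool → Bool → List ℕ → ℕ
dascWith lo hi [] = 0
dascWith lo hi (x ∷ w) = dascAt lo x w hi

-- The contribution of M β to the double ascents of α M β (+∞ if hi), M being largest.
afterMax : Bool → List ℕ → ℕ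
afterMax hi [] = ind hi
afterMax hi (y ∷ β) = dascAt false y β hi

dascAt-dasc : ∀ a b w → dascAt (a <ᵇ b) b w false ≡ dasc (a ∷ b ∷ w)
dascAt-dasc a b [] with a <ᵇ b
... | true = refl
... | false = refl
dascAt-dasc a b (c ∷ w) = cong (ind ((a <ᵇ b) ∧ (b <ᵇ c)) ℕ.+_) (dascAt-dasc b c w)

dasc≡dascWith : ∀ w → dasc w ≡ dascWith false false w
dasc≡dascWith [] = refl
dasc≡dascWith (_ ∷ []) = refl
dasc≡dascWith (a ∷ b ∷ w) = sym (dascAt-dasc a b w)

dascAt-dasc+rightEnd : ∀ a b w → dascAt (a <ᵇ b) b w true ≡ dasc (a ∷ b ∷ w) ℕ.+ rightEnd (a ∷ b ∷ w)
dascAt-dasc+rightEnd a b [] with a <ᵇ b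
... | true = refl
... | false = refl
dascAt-dasc+rightEnd a b (c ∷ w) =
  trans (cong (ind ((a <ᵇ b) ∧ (b <ᵇ c)) ℕ.+_) (dascAt-dasc+rightEnd b c w)) (sym (ℕP.+-assoc (ind ((a <ᵇ b) ∧ (b <ᵇ c))) _ _))

lrdasc≡dascWith : ∀ w → lrdasc w ≡ dascWith true true w
lrdasc≡dascWith [] = refl
lrdasc≡dascWith (_ ∷ []) = refl
lrdasc≡dascWith (a ∷ b ∷ w) = begin
  dasc (a ∷ b ∷ w) ℕ.+ ind (a <ᵇ b) ℕ.+ rightEnd (a ∷ b ∷ w) ℕ.+ 0
    ≡⟨ ℕP.+-identityʳ _ ⟩
  dasc (a ∷ b ∷ w) ℕ.+ ind (a <ᵇ b) ℕ.+ rightEnd (a ∷ b ∷ w)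
    ≡⟨ cong (ℕ._+ rightEnd (a ∷ b ∷ w)) (ℕP.+-comm (dasc (a ∷ b ∷ w)) _) ⟩
  ind (a <ᵇ b) ℕ.+ dasc (a ∷ b ∷ w) ℕ.+ rightEnd (a ∷ b ∷ w)
    ≡⟨ ℕP.+-assoc (ind (a <ᵇ b)) _ _ ⟩
  ind (a <ᵇ b) ℕ.+ (dasc (a ∷ b ∷ w) ℕ.+ rightEnd (a ∷ b ∷ w))
    ≡⟨ cong (ind (a <ᵇ b) ℕ.+_) (dascAt-dasc+rightEnd a b w) ⟨
  dascAt true a (b ∷ w) true ∎

dascAt-max : ∀ {M} hi β → Below M β → dascAt true M β hi ≡ afterMax hi β
dascAt-max hi [] _ = refl
dascAt-max {M} hi (y ∷ β) (y<M ∷ _) rewrite >ᵇ-false {y} {M} y<M = refl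

dascAt-insertMax : ∀ {M} p x α β hi → x < M → Below M α → Below M β →
                   dascAt p x (α ++ M ∷ β) hi ≡ dascAt p x α true ℕ.+ afterMax hi β
dascAt-insertMax {M} p x [] β hi x<M _ β<M rewrite <ᵇ-true x<M | dascAt-max {M} hi β β<M with p
... | true = refl
... | false = refl
dascAt-insertMax p x (y ∷ α) β hi x<M (y<M ∷ α<M) β<M =
  trans (cong (ind (p ∧ (x <ᵇ y)) ℕ.+_) (dascAt-insertMax (x <ᵇ y) y α β hi y<M α<M β<M))
        (sym (ℕP.+-assoc (ind (p ∧ (x <ᵇ y))) _ _))

dascWith-insertMax : ∀ {M} lo α β → Below M α → Below M β →
                     dascWith lo lo (α ++ M ∷ β) ≡ dascWith lo true α ℕ.+ afterMax lo β
dascWith-insertMax lo [] [] _ _ with lo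
... | true = refl
... | false = refl
dascWith-insertMax {M} lo [] (y ∷ β) _ (y<M ∷ _) rewrite >ᵇ-false {y} {M} y<M with lo
... | true = refl
... | false = refl
dascWith-insertMax lo (x ∷ α) β (x<M ∷ α<M) β<M = dascAt-insertMax lo x α β lo x<M α<M β<M

dascAt-invariant : ∀ {x x' w w'} p hi → Pointwise (SameOrder x x') w w' → w ≅ w' → dascAt p x w hi ≡ dascAt p x' w' hi
dascAt-invariant p hi [] [] = refl
dascAt-invariant {x} {x'} {y ∷ _} {y' ∷ _} p hi ((x<y≡x'<y' , _) ∷ _) (q ∷ w≅w') rewrite x<y≡x'<y' =
  cong (ind (p ∧ (x' <ᵇ y')) ℕ.+_) (dascAt-invariant (x' <ᵇ y') hi q w≅w')

dascWith-invariant : ∀ lo hi {w w'} → w ≅ w' → dascWith lo hi w ≡ dascWith lo hi w'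
dascWith-invariant lo hi [] = refl
dascWith-invariant lo hi (p ∷ w≅w') = dascAt-invariant lo hi p w≅w'

module DoubleAscentSums (t : ℤ) where

  dascWeight lrdascWeight rightWeight afterMaxWeight : WordFn
  dascWeight w = t ^ dascWith false false w
  lrdascWeight w = t ^ dascWith true true w
  rightWeight w = t ^ dascWith false true w
  afterMaxWeight w = t ^ afterMax true w

  ∂-dascWeight : ∀ {M} w → Below M w → ∂ M dascWeight w ≡ (rightWeight ∙ dascWeight) w
  ∂-dascWeight {M} = ∂-factor M dascWeight rightWeight dascWeight λ α β α<M β<M → begin
    t ^ dascWith false false (α ++ M ∷ β)            ≡⟨ cong (t ^_) (dascWith-insertMax false α β α<M β<M) ⟩
    t ^ (dascWith false true α ℕ.+ afterMax false β) ≡⟨ ℤP.^-distribˡ-+-* t (dascWith false true α) _ ⟩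
    rightWeight α * t ^ afterMax false β             ≡⟨ cong (rightWeight α *_) (afterMax-false β) ⟩
    rightWeight α * dascWeight β                     ∎
    where
    afterMax-false : ∀ β → t ^ afterMax false β ≡ dascWeight β
    afterMax-false [] = refl
    afterMax-false (_ ∷ _) = refl

  ∂-lrdascWeight : ∀ {M} w → Below M w → ∂ M lrdascWeight w ≡ (lrdascWeight ∙ afterMaxWeight) w
  ∂-lrdascWeight {M} = ∂-factor M lrdascWeight lrdascWeight afterMaxWeight λ α β α<M β<M →
    trans (cong (t ^_) (dascWith-insertMax true α β α<M β<M)) (ℤP.^-distribˡ-+-* t (dascWith true true α) _)

  -- afterMaxWeight and rightWeight differ only on the empty word, where they are t and 1.
  ∙-afterMaxWeight : ∀ f w → (f ∙ afterMaxWeight) w ≡ (f ∙ rightWeight) w + f w * (t - + 1)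
  ∙-afterMaxWeight f = ∙-update-[] f afterMaxWeight rightWeight (t - + 1) (t*1≡1+[t-1] t) (λ _ _ → refl)
    where
    t*1≡1+[t-1] : ∀ t → t * + 1 ≡ + 1 + (t - + 1)
    t*1≡1+[t-1] = solve-∀

  -- inc w is (1 − t)^|w| if w is increasing and 0 otherwise; incAbove a w
  -- is the same for the word a ∷ w, without the factor for a.
  incAbove : ℕ → WordFn
  incAbove a [] = + 1
  incAbove a (y ∷ w) = if a <ᵇ y then (+ 1 - t) * incAbove y w else + 0

  inc : WordFn
  inc [] = + 1
  inc (x ∷ w) = (+ 1 - t) * incAbove x w

  incAbove-invariant : ∀ {a a' w w'} → Pointwise (SameOrder a a') w w' → w ≅ w' → incAbove a w ≡ incAbove a' w'
  incAbove-invariant [] [] = refl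
  incAbove-invariant {a} {a'} {y ∷ _} {y' ∷ _} ((a<y≡a'<y' , _) ∷ _) (q ∷ w≅w') rewrite a<y≡a'<y' with a' <ᵇ y'
  ... | true = cong ((+ 1 - t) *_) (incAbove-invariant q w≅w')
  ... | false = refl

  inc-invariant : OrderInvariant inc
  inc-invariant [] = refl
  inc-invariant (p ∷ w≅w') = cong ((+ 1 - t) *_) (incAbove-invariant p w≅w')

  [1-t]*0+x≡x : ∀ x → (+ 1 - t) * + 0 + x ≡ x
  [1-t]*0+x≡x x = trans (cong (_+ x) (ℤP.*-zeroʳ (+ 1 - t))) (ℤP.+-identityˡ x)

  ∂-incAbove : ∀ {M} a w → a < M → Below M w → ∂ M (incAbove a) w ≡ (+ 1 - t) * incAbove a w
  ∂-incAbove {M} a [] a<M _ rewrite <ᵇ-true a<M = ℤP.+-identityʳ _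
  ∂-incAbove {M} a (y ∷ w) a<M (y<M ∷ w<M) = begin
    ∂ M (incAbove a) (y ∷ w)                                    ≡⟨ ∂-∷ M (incAbove a) y w ⟩
    incAbove a (M ∷ y ∷ w) + ∂ M (incAbove a ∘ (y ∷_)) w        ≡⟨ cong₂ _+_ incAbove-M (∂-tail (a <ᵇ y)) ⟩
    (+ 1 - t) * + 0 + (+ 1 - t) * incAbove a (y ∷ w)            ≡⟨ [1-t]*0+x≡x _ ⟩
    (+ 1 - t) * incAbove a (y ∷ w)                              ∎
    where
    incAbove-M : incAbove a (M ∷ y ∷ w) ≡ (+ 1 - t) * + 0
    incAbove-M rewrite <ᵇ-true a<M | >ᵇ-false y<M = refl
    ∂-tail : ∀ b → ∂ M (λ u → if b then (+ 1 - t) * incAbove y u else + 0) w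
                   ≡ (+ 1 - t) * (if b then (+ 1 - t) * incAbove y w else + 0)
    ∂-tail true = trans (∂-* M (+ 1 - t) (incAbove y) w) (cong ((+ 1 - t) *_) (∂-incAbove y w y<M w<M))
    ∂-tail false = trans (sumOver-zero (insertAll M w)) (sym (ℤP.*-zeroʳ (+ 1 - t)))

  ∂-inc : ∀ {M} w → Below M w → ∂ M inc w ≡ (+ 1 - t) * inc w
  ∂-inc [] _ = ℤP.+-identityʳ _
  ∂-inc {M} (y ∷ w) (y<M ∷ w<M) = begin
    ∂ M inc (y ∷ w)                                                      ≡⟨ ∂-∷ M inc y w ⟩
    (+ 1 - t) * incAbove M (y ∷ w) + ∂ M (λ u → (+ 1 - t) * incAbove y u) w
      ≡⟨ cong₂ _+_ (cong ((+ 1 - t) *_) incAbove-M) (trans (∂-* M (+ 1 - t) (incAbove y) w)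
                                                            (cong ((+ 1 - t) *_) (∂-incAbove y w y<M w<M))) ⟩
    (+ 1 - t) * + 0 + (+ 1 - t) * ((+ 1 - t) * incAbove y w)             ≡⟨ [1-t]*0+x≡x _ ⟩
    (+ 1 - t) * inc (y ∷ w)                                              ∎
    where
    incAbove-M : incAbove M (y ∷ w) ≡ + 0
    incAbove-M rewrite >ᵇ-false y<M = refl

  sumPerms-inc : ∀ n → sumPerms inc n ≡ (+ 1 - t) ^ n
  sumPerms-inc zero = refl
  sumPerms-inc (suc n) = begin
    sumPerms inc (suc n)                ≡⟨ sumPerms-∂ n ∂-inc ⟩
    sumPerms (λ π → (+ 1 - t) * inc π) n ≡⟨ sumOver-* (+ 1 - t) inc (perms n) ⟩
    (+ 1 - t) * sumPerms inc n          ≡⟨ cong ((+ 1 - t) *_) (sumPerms-inc n) ⟩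
    (+ 1 - t) ^ suc n                   ∎

  dascWeight-recurrence : ∀ n → sumPerms dascWeight (suc n) ≡ (sumPerms dascWeight ⊛ sumPerms rightWeight) n
  dascWeight-recurrence n = begin
    sumPerms dascWeight (suc n)                        ≡⟨ sumPerms-∂ n ∂-dascWeight ⟩
    sumPerms (rightWeight ∙ dascWeight) n              ≡⟨ sumPerms-∙ n (cong (t ^_) ∘ dascWith-invariant false true)
                                                                       (cong (t ^_) ∘ dascWith-invariant false false) ⟩
    (sumPerms rightWeight ⊛ sumPerms dascWeight) n     ≡⟨ ⊛-comm (sumPerms rightWeight) (sumPerms dascWeight) n ⟩
    (sumPerms dascWeight ⊛ sumPerms rightWeight) n     ∎

  ∂-inc∙lrdascWeight : ∀ {M} w → Below M w → ∂ M (inc ∙ lrdascWeight) w ≡ (inc ∙ lrdascWeight ∙ rightWeight) w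
  ∂-inc∙lrdascWeight {M} w w<M = begin
    ∂ M (inc ∙ lrdascWeight) w
      ≡⟨ ∂-∙ M inc lrdascWeight w ⟩
    (∂ M inc ∙ lrdascWeight) w + (inc ∙ ∂ M lrdascWeight) w
      ≡⟨ cong₂ _+_ (trans (∙-congᴮ (λ u u<M → ∂-inc u u<M) (λ _ _ → refl) w<M) (∙-*ˡ (+ 1 - t) inc lrdascWeight w))
                   (trans (∙-congᴮ (λ _ _ → refl) (λ u u<M → ∂-lrdascWeight u u<M) w<M)
                          (sym (∙-assoc inc lrdascWeight afterMaxWeight w))) ⟩
    (+ 1 - t) * (inc ∙ lrdascWeight) w + (inc ∙ lrdascWeight ∙ afterMaxWeight) w
      ≡⟨ cong (_+_ ((+ 1 - t) * (inc ∙ lrdascWeight) w)) (∙-afterMaxWeight (inc ∙ lrdascWeight) w) ⟩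
    (+ 1 - t) * (inc ∙ lrdascWeight) w + ((inc ∙ lrdascWeight ∙ rightWeight) w + (inc ∙ lrdascWeight) w * (t - + 1))
      ≡⟨ cancel t _ _ ⟩
    (inc ∙ lrdascWeight ∙ rightWeight) w ∎
    where
    cancel : ∀ t a c → (+ 1 - t) * a + (c + a * (t - + 1)) ≡ c
    cancel = solve-∀

  inc∙lrdascWeight-recurrence : ∀ n → sumPerms (inc ∙ lrdascWeight) (suc n)
                                      ≡ (sumPerms (inc ∙ lrdascWeight) ⊛ sumPerms rightWeight) n
  inc∙lrdascWeight-recurrence n =
    trans (sumPerms-∂ n ∂-inc∙lrdascWeight)
          (sumPerms-∙ n (∙-invariant inc-invariant (cong (t ^_) ∘ dascWith-invariant true true))
                        (cong (t ^_) ∘ dascWith-invariant false true))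

corollary14 : (t : ℤ) (n : ℕ) → Pdasc t n ≡ RHS t n
corollary14 t n = begin
  Pdasc t n
    ≡⟨ sumOver-cong (perms n) (cong (t ^_) ∘ dasc≡dascWith) ⟩
  sumPerms dascWeight n
    ≡⟨ ⊛-recurrence-unique _ _ (sumPerms rightWeight) refl dascWeight-recurrence inc∙lrdascWeight-recurrence n ⟩
  sumPerms (inc ∙ lrdascWeight) n
    ≡⟨ sumPerms-∙ n inc-invariant (cong (t ^_) ∘ dascWith-invariant true true) ⟩
  (sumPerms inc ⊛ sumPerms lrdascWeight) n
    ≡⟨ ⊛-cong n (λ k _ → sumPerms-inc k) (λ k _ → sumOver-cong (perms k) (cong (t ^_) ∘ sym ∘ lrdasc≡dascWith)) ⟩
  ((λ k → (+ 1 - t) ^ k) ⊛ Plrdasc t) n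
    ≡⟨ sumOver-applyUpTo (λ k → + (n C k) * (+ 1 - t) ^ k * Plrdasc t (n ∸ k)) (λ k → k) n ⟨
  RHS t n ∎
  where open DoubleAscentSums t
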